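{- Let $a\geq 0$ and $b\geq1$ be integers and let $G=\Lambda(a,b,0,1)$ be the digraph with vertices $u_1,\dots,u_a,w_1,\dots,w_b,v$ whose arcs are $(u_i,u_{i'})$ for $i\neq i'$, $(u_i,w_j)$, $(w_j,v)$, $(v,w_j)$ and $(v,u_i)$ for all $i,j$. Assign the indeterminates $z_i$ to $u_i$, $y_j$ to $w_j$ and $x$ to $v$, so that, ordering the vertices as $u_1,\dots,u_a,w_1,\dots,w_b,v$, $$D_X(G)=\operatorname{diag}(z_1,\dots,z_a,y_1,\dots,y_b,x)+\begin{bmatrix} J_a-I_a & J_{a,b} & 2J_{a,1}\\ 2J_{b,a} & 2J_b-2I_b & J_{b,1}\\ J_{1,a} & J_{1,b} & 0\end{bmatrix}.$$ Let $$L=\operatorname{diag}(x,y_1,\dots,y_b,z_1,\dots,z_a)+\begin{bmatrix} 0 & J_{1,b} & J_{1,a}\\ (1-2x)J_{b,1} & -2I_b & 0_{b,a}\\ (2-x)J_{a,1} & 0_{a,b} & -I_a\end{bmatrix}.$$ Then $D_X(G)$ and $L$ are equivalent, i.e. $L=PD_X(G)Q$ for some $P,Q\in GL_{a+b+1}(\mathbb{Z})$, and for every $k$ the $k$-th distance ideal $I_k(G)$ equals the ideal of $\mathbb{Z}[z_1,\dots,z_a,y_1,\dots,y_b,x]$ generated by the $k\times k$ minors of $L$.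
   Context: $D_X(G)=\operatorname{diag}(\text{vertex indeterminates})+D(G)$ where $D(G)$ is the (directed) distance matrix, $\operatorname{dist}(u,v)$ being the number of arcs of a shortest directed $uv$-walk. $I_k(G)$ is the ideal generated by all $k\times k$ minors of $D_X(G)$ in the polynomial ring over $\mathbb{Z}$ in the vertex indeterminates. $I_m$ is the identity matrix, $J_m$ and $J_{m,p}$ the all-ones matrices of sizes $m\times m$ and $m\times p$, and $0_{m,p}$ the zero matrix. -}

module Defs where

open import Data.Nat as ℕ using (ℕ; zero; suc)
open import Data.Nat.Properties as ℕP using ()
open import Data.Integer as ℤ using (ℤ; +_; -[1+_])
open import Data.Fin as Fin using (Fin; zero; suc; splitAt; cast; punchIn; toℕ)
open import Data.Fin.Properties using (_≟_)
open import Data.Sum using (_⊎_; inj₁; inj₂)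
open import Data.Product using (Σ; _×_; _,_; ∃)
open import Data.Bool using (Bool; true; false; if_then_else_)
open import Relation.Nullary using (yes; no)
open import Relation.Nullary.Decidable using (⌊_⌋)
open import Relation.Binary.PropositionalEquality using (_≡_; refl; sym; trans; cong)

-- A polynomial is given by a syntactic term; two terms are identified
-- (_≈_) when they define the same function V → ℤ.  Since ℤ is an
-- infinite integral domain, this is exactly equality in ℤ[V].

infixl 6 _⊕_
infixl 7 _⊗_

data Poly (V : Set) : Set where
  con  : ℤ → Poly V
  var  : V → Poly V
  _⊕_  : Poly V → Poly V → Poly V
  _⊗_  : Poly V → Poly V → Poly V
  ⊖_   : Poly V → Poly V

eval : ∀ {V} → (V → ℤ) → Poly V → ℤ
eval ρ (con c) = c
eval ρ (var v) = ρ v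
eval ρ (p ⊕ q) = eval ρ p ℤ.+ eval ρ q
eval ρ (p ⊗ q) = eval ρ p ℤ.* eval ρ q
eval ρ (⊖ p)   = ℤ.- eval ρ p

infix 4 _≈_
_≈_ : ∀ {V} → Poly V → Poly V → Set
p ≈ q = ∀ ρ → eval ρ p ≡ eval ρ q

sumP : ∀ {V n} → (Fin n → Poly V) → Poly V
sumP {n = zero}  f = con (+ 0)
sumP {n = suc n} f = f zero ⊕ sumP (λ i → f (suc i))

sumℤ : ∀ {n} → (Fin n → ℤ) → ℤ
sumℤ {zero}  f = + 0
sumℤ {suc n} f = f zero ℤ.+ sumℤ (λ i → f (suc i))

Mat : Set → ℕ → Set
Mat A n = Fin n → Fin n → A

sign : ∀ {V} → ℕ → Poly V
sign zero          = con (+ 1)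
sign (suc zero)    = con (ℤ.- (+ 1))
sign (suc (suc n)) = sign n

det : ∀ {V k} → Mat (Poly V) k → Poly V
det {k = zero}  M = con (+ 1)
det {k = suc k} M =
  sumP (λ j → sign (toℕ j) ⊗ M zero j ⊗ det (λ r c → M (suc r) (punchIn j c)))

Increasing : ∀ {k n} → (Fin k → Fin n) → Set
Increasing f = ∀ i j → i Fin.< j → f i Fin.< f j

IsMinor : ∀ {V n} → Mat (Poly V) n → (k : ℕ) → Poly V → Set
IsMinor {n = n} M k p =
  Σ (Fin k → Fin n) λ r → Σ (Fin k → Fin n) λ c →
    Increasing r × Increasing c × (p ≡ det (λ i j → M (r i) (c j)))

data InIdeal {V : Set} (S : Poly V → Set) : Poly V → Set where
  gen  : ∀ {p} → S p → InIdeal S p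
  zer  : InIdeal S (con (+ 0))
  add  : ∀ {p q} → InIdeal S p → InIdeal S q → InIdeal S (p ⊕ q)
  mul  : ∀ {p} (c : Poly V) → InIdeal S p → InIdeal S (c ⊗ p)
  resp : ∀ {p q} → p ≈ q → InIdeal S p → InIdeal S q

MinorIdeal : ∀ {V n} → Mat (Poly V) n → ℕ → Poly V → Set
MinorIdeal M k = InIdeal (IsMinor M k)

_≐_ : ∀ {V} → (Poly V → Set) → (Poly V → Set) → Set
I ≐ J = (∀ p → I p → J p) × (∀ p → J p → I p)

_·ℤ_ : ∀ {n} → Mat ℤ n → Mat ℤ n → Mat ℤ n
(A ·ℤ B) i j = sumℤ (λ k → A i k ℤ.* B k j)

Iℤ : ∀ {n} → Mat ℤ n
Iℤ i j = if ⌊ i ≟ j ⌋ then + 1 else + 0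

GL : ∀ {n} → Mat ℤ n → Set
GL {n} P = Σ (Mat ℤ n) λ P' →
  (∀ i j → (P ·ℤ P') i j ≡ Iℤ i j) × (∀ i j → (P' ·ℤ P) i j ≡ Iℤ i j)

triple : ∀ {V n} → Mat ℤ n → Mat (Poly V) n → Mat ℤ n → Mat (Poly V) n
triple P M Q i j = sumP (λ k → sumP (λ l → con (P i k) ⊗ M k l ⊗ con (Q l j)))

data Vert (a b : ℕ) : Set where
  u : Fin a → Vert a b
  w : Fin b → Vert a b
  v : Vert a b

-- the indeterminates z_i, y_j, x are var (u i), var (w j), var v
Var : ℕ → ℕ → Set
Var = Vert

N : ℕ → ℕ → ℕ
N a b = a ℕ.+ b ℕ.+ 1

vertD : ∀ a b → Fin (N a b) → Vert a b
vertD a b i with splitAt (a ℕ.+ b) i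
... | inj₂ _ = v
... | inj₁ k with splitAt a k
...   | inj₁ p = u p
...   | inj₂ q = w q

N≡ : ∀ a b → N a b ≡ suc (b ℕ.+ a)
N≡ a b = trans (ℕP.+-comm (a ℕ.+ b) 1) (cong suc (ℕP.+-comm a b))

vertL' : ∀ a b → Fin (suc (b ℕ.+ a)) → Vert a b
vertL' a b zero = v
vertL' a b (suc k) with splitAt b k
... | inj₁ q = w q
... | inj₂ p = u p

vertL : ∀ a b → Fin (N a b) → Vert a b
vertL a b i = vertL' a b (cast (N≡ a b) i)

dist : ∀ {a b} → Vert a b → Vert a b → ℤ
dist (u i) (u i') = if ⌊ i ≟ i' ⌋ then + 0 else + 1
dist (u i) (w j)  = + 1
dist (u i) v      = + 2
dist (w j) (u i)  = + 2
dist (w j) (w j') = if ⌊ j ≟ j' ⌋ then + 0 else + 2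
dist (w j) v      = + 1
dist v (u i)      = + 1
dist v (w j)      = + 1
dist v v          = + 0

DX : ∀ a b → Mat (Poly (Var a b)) (N a b)
DX a b i j =
  (if ⌊ i ≟ j ⌋ then var (vertD a b i) else con (+ 0))
  ⊕ con (dist (vertD a b i) (vertD a b j))

Ik : ∀ a b → ℕ → Poly (Var a b) → Set
Ik a b k = MinorIdeal (DX a b) k

Lblock : ∀ {a b} → Vert a b → Vert a b → Poly (Var a b)
Lblock v v       = con (+ 0)
Lblock v (w j)   = con (+ 1)
Lblock v (u i)   = con (+ 1)
Lblock (w j) v   = con (+ 1) ⊕ (⊖ (con (+ 2) ⊗ var v))
Lblock (w j) (w j') = if ⌊ j ≟ j' ⌋ then con (ℤ.- (+ 2)) else con (+ 0)
Lblock (w j) (u i) = con (+ 0)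
Lblock (u i) v   = con (+ 2) ⊕ (⊖ var v)
Lblock (u i) (w j) = con (+ 0)
Lblock (u i) (u i') = if ⌊ i ≟ i' ⌋ then con (ℤ.- (+ 1)) else con (+ 0)

Lmat : ∀ a b → Mat (Poly (Var a b)) (N a b)
Lmat a b i j =
  (if ⌊ i ≟ j ⌋ then var (vertL a b i) else con (+ 0))
  ⊕ Lblock (vertL a b i) (vertL a b j)

{-# OPTIONS --safe #-}
module Submission where

open import Defs
open import Data.Nat using (ℕ; _≤_)
open import Data.Integer using (ℤ)
open import Data.Product using (Σ; _×_)

open import Algebra.Bundles using (AbelianGroup)
import Data.Integer.Properties as ℤP
open import Algebra.Properties.Group (AbelianGroup.group ℤP.+-0-abelianGroup) using (inverseˡ-unique)
open import Algebra.Properties.Semiring.Sum ℤP.+-*-semiring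
  using (sum; sum-cong-≗; sum-replicate-zero; sum-remove; ∑-distrib-+; ∑-comm; *-distribˡ-sum; *-distribʳ-sum)
open import Data.Bool using (if_then_else_)
open import Data.Empty using (⊥-elim)
open import Data.Fin as Fin using (Fin; zero; suc; toℕ; punchIn; splitAt; cast; _↑ˡ_; _↑ʳ_)
open import Data.Fin.Properties
  using (_≟_; <-cmp; suc-injective; toℕ<n; toℕ-injective; punchInᵢ≢i; cast-involutive;
         splitAt-↑ˡ; splitAt-↑ʳ; splitAt⁻¹-↑ˡ; splitAt⁻¹-↑ʳ)
open import Data.Integer using (+_; +0; +[1+_]; -[1+_]; 0ℤ; 1ℤ; -1ℤ; _+_; _*_; -_; _^_)
open import Data.Integer.Tactic.RingSolver using (solve-∀)
open import Data.Nat as ℕ using (zero; suc; z≤n; s≤s)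
import Data.Nat.Properties as ℕP
open import Data.Product using (_,_; proj₁; proj₂; ∃-syntax)
open import Data.Sum using (inj₁; inj₂)
open import Data.Vec.Functional using (_∷_; tail; foldr)
open import Function using (_∘_; _↔_; Inverse; Injection; mk↔ₛ′)
open import Function.Definitions using (Injective)
open import Function.Properties.Inverse using (↔-refl; ↔-sym; ↔-trans; ↔⇒↣)
open import Relation.Nullary using (¬_; yes; no)
open import Relation.Nullary.Decidable using (⌊_⌋; map′)
open import Relation.Nullary.Negation using (contradiction)
open import Relation.Binary.Definitions using (DecidableEquality; tri<; tri≈; tri>)
open import Relation.Binary.PropositionalEquality hiding (resp)

-- Listing the vertices as v, w, u and adding −2 (resp. −1) times the row of v
-- to the rows of the w_j (resp. u_i) turns D_X(G) into L; both operations are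
-- invertible over ℤ.  For the ideals: if M′ = P · M · (column permutation), the
-- first-row Laplace expansion is multilinear in the rows, so a k×k minor of M′
-- is a ℤ-combination of determinants of k (possibly repeated) rows of M taken
-- in k distinct columns.  Sorting the rows with the alternating property, and
-- the columns with a permutation matrix and det (XY) = det X · det Y, makes each
-- of them 0 or ± a k×k minor of M.  Applied to P and to P⁻¹ this gives both
-- inclusions I_k(G) ⊆ I_k(L) ⊆ I_k(G).

sumℤ≡sum : ∀ {n} (f : Fin n → ℤ) → sumℤ f ≡ sum f
sumℤ≡sum {zero}  f = refl
sumℤ≡sum {suc n} f = cong (_+_ (f zero)) (sumℤ≡sum (f ∘ suc))

sum-zero : ∀ {n} {f : Fin n → ℤ} → (∀ i → f i ≡ 0ℤ) → sum f ≡ 0ℤ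
sum-zero {n} f≡0 = trans (sum-cong-≗ f≡0) (sum-replicate-zero n)

sum-single : ∀ {n} (f : Fin n → ℤ) i → (∀ j → j ≢ i → f j ≡ 0ℤ) → sum f ≡ f i
sum-single {suc n} f i f≡0 = begin
  sum f                      ≡⟨ sum-remove f ⟩
  f i + sum (f ∘ punchIn i)  ≡⟨ cong (_+_ (f i)) (sum-zero (λ j → f≡0 _ (punchInᵢ≢i i j))) ⟩
  f i + 0ℤ                   ≡⟨ ℤP.+-identityʳ (f i) ⟩
  f i                        ∎
  where open ≡-Reasoning

product : ∀ {k} → (Fin k → ℤ) → ℤ
product = foldr _*_ 1ℤ

sumMaps : ∀ k {n} → ((Fin k → Fin n) → ℤ) → ℤ
sumMaps zero    F = F (λ ())
sumMaps (suc k) F = sum λ m → sumMaps k (λ g → F (m ∷ g))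

sumMaps-cong : ∀ k {n} {F G : (Fin k → Fin n) → ℤ} → (∀ g → F g ≡ G g) → sumMaps k F ≡ sumMaps k G
sumMaps-cong zero    F≗G = F≗G _
sumMaps-cong (suc k) F≗G = sum-cong-≗ (λ m → sumMaps-cong k (F≗G ∘ (m ∷_)))

*-distribˡ-sumMaps : ∀ k {n} c (F : (Fin k → Fin n) → ℤ) → c * sumMaps k F ≡ sumMaps k (λ g → c * F g)
*-distribˡ-sumMaps zero    c F = refl
*-distribˡ-sumMaps (suc k) c F = trans (*-distribˡ-sum c (λ m → sumMaps k (F ∘ (m ∷_))))
                                       (sum-cong-≗ λ m → *-distribˡ-sumMaps k c (F ∘ (m ∷_)))

*-distribʳ-sumMaps : ∀ k {n} c (F : (Fin k → Fin n) → ℤ) → sumMaps k F * c ≡ sumMaps k (λ g → F g * c)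
*-distribʳ-sumMaps zero    c F = refl
*-distribʳ-sumMaps (suc k) c F = trans (*-distribʳ-sum c (λ m → sumMaps k (F ∘ (m ∷_))))
                                       (sum-cong-≗ λ m → *-distribʳ-sumMaps k c (F ∘ (m ∷_)))

sumMaps-sum : ∀ k {m n} (F : Fin m → (Fin k → Fin n) → ℤ) →
  sumMaps k (λ g → sum λ j → F j g) ≡ sum λ j → sumMaps k (F j)
sumMaps-sum zero    F = refl
sumMaps-sum (suc k) F = trans (sum-cong-≗ λ m → sumMaps-sum k (λ j → F j ∘ (m ∷_)))
                              (∑-comm (λ m j → sumMaps k (F j ∘ (m ∷_))))

detℤ : ∀ {k} → Mat ℤ k → ℤ
detℤ {zero}  M = 1ℤ
detℤ {suc k} M = sum λ j → -1ℤ ^ toℕ j * M zero j * detℤ (λ r c → M (suc r) (punchIn j c))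

detℤ-cong : ∀ {k} {M M′ : Mat ℤ k} → (∀ i j → M i j ≡ M′ i j) → detℤ M ≡ detℤ M′
detℤ-cong {zero}  M≗M′ = refl
detℤ-cong {suc k} M≗M′ = sum-cong-≗ λ j →
  cong₂ (λ m d → -1ℤ ^ toℕ j * m * d) (M≗M′ zero j) (detℤ-cong (λ r c → M≗M′ (suc r) (punchIn j c)))

detRows : ∀ {k n} → (Fin n → Fin k → ℤ) → (Fin k → Fin n) → ℤ
detRows B f = detℤ (B ∘ f)

eval-sumP : ∀ {V n} (ρ : V → ℤ) (f : Fin n → Poly V) → eval ρ (sumP f) ≡ sum (eval ρ ∘ f)
eval-sumP {n = zero}  ρ f = refl
eval-sumP {n = suc n} ρ f = cong (_+_ (eval ρ (f zero))) (eval-sumP ρ (f ∘ suc))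

eval-sign : ∀ {V} (ρ : V → ℤ) n → eval ρ (sign n) ≡ -1ℤ ^ n
eval-sign ρ zero          = refl
eval-sign ρ (suc zero)    = refl
eval-sign ρ (suc (suc n)) = trans (eval-sign ρ n) (sym (-1*-1* (-1ℤ ^ n)))
  where
  -1*-1* : ∀ x → -1ℤ * (-1ℤ * x) ≡ x
  -1*-1* = solve-∀

eval-det : ∀ {V k} (ρ : V → ℤ) (M : Mat (Poly V) k) → eval ρ (det M) ≡ detℤ (λ i j → eval ρ (M i j))
eval-det {k = zero}  ρ M = refl
eval-det {k = suc k} ρ M =
  trans (eval-sumP ρ (λ j → sign (toℕ j) ⊗ M zero j ⊗ det (minor j))) (sum-cong-≗ λ j →
    cong₂ (λ s d → s * eval ρ (M zero j) * d) (eval-sign ρ (toℕ j)) (eval-det ρ (minor j)))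
  where
  minor : Fin (suc k) → Mat (Poly _) k
  minor j r c = M (suc r) (punchIn j c)

Extensional : ∀ {k m} → ((Fin k → Fin m) → ℤ) → Set
Extensional R = ∀ {σ τ} → σ ≗ τ → R σ ≡ R τ

-- Laplace expansion along the two rows x and y; R σ stands for the determinant
-- of the remaining rows restricted to the columns σ.
twoRowExpansion : ∀ {k} (x y : Fin (2 ℕ.+ k) → ℤ) → ((Fin k → Fin (2 ℕ.+ k)) → ℤ) → ℤ
twoRowExpansion x y R =
  sum λ j → -1ℤ ^ toℕ j * x j * sum λ j′ → -1ℤ ^ toℕ j′ * y (punchIn j j′) * R (punchIn j ∘ punchIn j′)

expansionWithoutColumn₀ : ∀ {k} (y : Fin (2 ℕ.+ k) → ℤ) → ((Fin k → Fin (2 ℕ.+ k)) → ℤ) → ℤ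
expansionWithoutColumn₀ y R = sum λ j → -1ℤ ^ toℕ j * y (suc j) * R (suc ∘ punchIn j)

-- Sorting the terms by which of x, y (if any) uses column 0; in the last group
-- column 0 passes to the remaining rows.
twoRowExpansion-suc : ∀ {k} (x y : Fin (3 ℕ.+ k) → ℤ) R → Extensional R →
  twoRowExpansion x y R ≡
    x zero * expansionWithoutColumn₀ y R +
    (- y zero * expansionWithoutColumn₀ x R + twoRowExpansion (tail x) (tail y) (λ τ → R (zero ∷ suc ∘ τ)))
twoRowExpansion-suc {k} x y R R-ext =
  cong₂ _+_ (cong (_* expansionWithoutColumn₀ y R) (ℤP.*-identityˡ (x zero))) (begin
    sum (λ j → -1ℤ * s j * x (suc j) *
                 (1ℤ * y zero * R₁ j + sum λ j′ → -1ℤ * s j′ * y (suc (punchIn j j′)) * R₂ j j′))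
      ≡⟨ sum-cong-≗ (λ j → cong (λ t → -1ℤ * s j * x (suc j) * (1ℤ * y zero * R₁ j + t)) (inner j)) ⟩
    sum (λ j → -1ℤ * s j * x (suc j) * (1ℤ * y zero * R₁ j + -1ℤ * I j))
      ≡⟨ sum-cong-≗ (λ j → regroup (s j) (x (suc j)) (y zero) (R₁ j) (I j)) ⟩
    sum (λ j → - y zero * (s j * x (suc j) * R₁ j) + s j * x (suc j) * I j)
      ≡⟨ ∑-distrib-+ (λ j → - y zero * (s j * x (suc j) * R₁ j)) (λ j → s j * x (suc j) * I j) ⟩
    sum (λ j → - y zero * (s j * x (suc j) * R₁ j)) + sum (λ j → s j * x (suc j) * I j)
      ≡⟨ cong (_+ sum (λ j → s j * x (suc j) * I j))
              (*-distribˡ-sum (- y zero) (λ j → s j * x (suc j) * R₁ j)) ⟨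
    - y zero * expansionWithoutColumn₀ x R + twoRowExpansion (tail x) (tail y) R′
      ∎)
  where
  open ≡-Reasoning
  s : ∀ {n} → Fin n → ℤ
  s j = -1ℤ ^ toℕ j
  R₁ : Fin (2 ℕ.+ k) → ℤ
  R₁ j = R (suc ∘ punchIn j)
  R₂ : Fin (2 ℕ.+ k) → Fin (suc k) → ℤ
  R₂ j j′ = R (punchIn (suc j) ∘ punchIn (suc j′))
  R′ : (Fin k → Fin (2 ℕ.+ k)) → ℤ
  R′ τ = R (zero ∷ suc ∘ τ)
  I : Fin (2 ℕ.+ k) → ℤ
  I j = sum λ j′ → s j′ * y (suc (punchIn j j′)) * R′ (punchIn j ∘ punchIn j′)
  R₂≡R′ : ∀ j j′ → R₂ j j′ ≡ R′ (punchIn j ∘ punchIn j′)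
  R₂≡R′ j j′ = R-ext {punchIn (suc j) ∘ punchIn (suc j′)} {zero ∷ suc ∘ punchIn j ∘ punchIn j′}
                     λ { zero → refl ; (suc c) → refl }
  -1*-assoc : ∀ σ a r → -1ℤ * σ * a * r ≡ -1ℤ * (σ * a * r)
  -1*-assoc = solve-∀
  inner : ∀ j → (sum λ j′ → -1ℤ * s j′ * y (suc (punchIn j j′)) * R₂ j j′) ≡ -1ℤ * I j
  inner j = begin
    (sum λ j′ → -1ℤ * s j′ * y (suc (punchIn j j′)) * R₂ j j′)
      ≡⟨ sum-cong-≗ (λ j′ → trans (cong (-1ℤ * s j′ * y (suc (punchIn j j′)) *_) (R₂≡R′ j j′))
                                  (-1*-assoc (s j′) (y (suc (punchIn j j′))) (R′ (punchIn j ∘ punchIn j′)))) ⟩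
    (sum λ j′ → -1ℤ * (s j′ * y (suc (punchIn j j′)) * R′ (punchIn j ∘ punchIn j′)))
      ≡⟨ *-distribˡ-sum -1ℤ (λ j′ → s j′ * y (suc (punchIn j j′)) * R′ (punchIn j ∘ punchIn j′)) ⟨
    -1ℤ * I j ∎
  regroup : ∀ σ a b r i → -1ℤ * σ * a * (1ℤ * b * r + -1ℤ * i) ≡ - b * (σ * a * r) + σ * a * i
  regroup = solve-∀

twoRowExpansion-cong : ∀ {k} (x y : Fin (2 ℕ.+ k) → ℤ) {R R′} → (∀ σ → R σ ≡ R′ σ) →
  twoRowExpansion x y R ≡ twoRowExpansion x y R′
twoRowExpansion-cong x y R≗R′ = sum-cong-≗ λ j → cong (-1ℤ ^ toℕ j * x j *_) (sum-cong-≗ λ j′ →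
  cong (-1ℤ ^ toℕ j′ * y (punchIn j j′) *_) (R≗R′ (punchIn j ∘ punchIn j′)))

twoRowExpansion-antisym : ∀ {k} (x y : Fin (2 ℕ.+ k) → ℤ) R → Extensional R →
  twoRowExpansion x y R + twoRowExpansion y x R ≡ 0ℤ
twoRowExpansion-antisym {zero} x y R R-ext = begin
  twoRowExpansion x y R + twoRowExpansion y x R
    ≡⟨ cong₂ _+_ (twoRowExpansion-cong x y R≡r) (twoRowExpansion-cong y x R≡r) ⟩
  twoRowExpansion x y (λ _ → r) + twoRowExpansion y x (λ _ → r)
    ≡⟨ antisym₂ (x zero) (x (suc zero)) (y zero) (y (suc zero)) r ⟩
  0ℤ ∎
  where
  open ≡-Reasoning
  r = R (λ ())
  R≡r : ∀ σ → R σ ≡ r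
  R≡r σ = R-ext (λ ())
  antisym₂ : ∀ a b c d r →
    (1ℤ * a * (1ℤ * d * r + 0ℤ) + (-1ℤ * b * (1ℤ * c * r + 0ℤ) + 0ℤ)) +
    (1ℤ * c * (1ℤ * b * r + 0ℤ) + (-1ℤ * d * (1ℤ * a * r + 0ℤ) + 0ℤ)) ≡ 0ℤ
  antisym₂ = solve-∀
twoRowExpansion-antisym {suc k} x y R R-ext = begin
  twoRowExpansion x y R + twoRowExpansion y x R
    ≡⟨ cong₂ _+_ (twoRowExpansion-suc x y R R-ext) (twoRowExpansion-suc y x R R-ext) ⟩
  (x zero * A y + (- y zero * A x + T (tail x) (tail y))) +
  (y zero * A x + (- x zero * A y + T (tail y) (tail x)))
    ≡⟨ cancel (x zero) (A y) (y zero) (A x) (T (tail x) (tail y)) (T (tail y) (tail x)) ⟩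
  T (tail x) (tail y) + T (tail y) (tail x)
    ≡⟨ twoRowExpansion-antisym (tail x) (tail y) R′ R′-ext ⟩
  0ℤ ∎
  where
  open ≡-Reasoning
  A : (Fin (3 ℕ.+ k) → ℤ) → ℤ
  A z = expansionWithoutColumn₀ z R
  R′ : (Fin k → Fin (2 ℕ.+ k)) → ℤ
  R′ τ = R (zero ∷ suc ∘ τ)
  R′-ext : Extensional R′
  R′-ext σ≗τ = R-ext λ { zero → refl ; (suc c) → cong suc (σ≗τ c) }
  T : (Fin (2 ℕ.+ k) → ℤ) → (Fin (2 ℕ.+ k) → ℤ) → ℤ
  T z z′ = twoRowExpansion z z′ R′
  cancel : ∀ a b c d t u → (a * b + (- c * d + t)) + (c * d + (- a * b + u)) ≡ t + u
  cancel = solve-∀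

detℤ-swap : ∀ {k} (x y : Fin (2 ℕ.+ k) → ℤ) (H : Fin k → Fin (2 ℕ.+ k) → ℤ) →
  detℤ (x ∷ y ∷ H) ≡ - detℤ (y ∷ x ∷ H)
detℤ-swap x y H = inverseˡ-unique (detℤ (x ∷ y ∷ H)) (detℤ (y ∷ x ∷ H))
  (twoRowExpansion-antisym x y (λ σ → detℤ (λ r → H r ∘ σ)) (λ σ≗τ → detℤ-cong λ r c → cong (H r) (σ≗τ c)))

infix 4 _⊆ʳ_

_⊆ʳ_ : ∀ {A : Set} {k m} → (Fin k → A) → (Fin m → A) → Set
f ⊆ʳ g = ∀ i → ∃[ t ] f i ≡ g t

⊆ʳ-refl : ∀ {A : Set} {k} {f : Fin k → A} → f ⊆ʳ f
⊆ʳ-refl i = i , refl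

⊆ʳ-trans : ∀ {A : Set} {k l m} {f : Fin k → A} {g : Fin l → A} {h : Fin m → A} →
  f ⊆ʳ g → g ⊆ʳ h → f ⊆ʳ h
⊆ʳ-trans f⊆g g⊆h i with f⊆g i
... | t , fi≡gt with g⊆h t
...   | s , gt≡hs = s , trans fi≡gt gt≡hs

∷⁺-⊆ʳ : ∀ {A : Set} {k m} (a : A) {f : Fin k → A} {g : Fin m → A} → f ⊆ʳ g → (a ∷ f) ⊆ʳ (a ∷ g)
∷⁺-⊆ʳ a f⊆g zero    = zero , refl
∷⁺-⊆ʳ a f⊆g (suc i) with f⊆g i
... | t , fi≡gt = suc t , fi≡gt

⊆ʳ-∷ : ∀ {A : Set} {k m} {f : Fin (suc k) → A} {g : Fin m → A} → tail f ⊆ʳ g → f ⊆ʳ (f zero ∷ g)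
⊆ʳ-∷ f⊆g zero    = zero , refl
⊆ʳ-∷ f⊆g (suc i) with f⊆g i
... | t , fi≡gt = suc t , fi≡gt

∷-⊆ʳ : ∀ {A : Set} {k m} {f : Fin (suc k) → A} {g : Fin m → A} → g ⊆ʳ tail f → (f zero ∷ g) ⊆ʳ f
∷-⊆ʳ g⊆f zero    = zero , refl
∷-⊆ʳ g⊆f (suc t) with g⊆f t
... | i , gt≡fi = suc i , gt≡fi

∷-swap-⊆ʳ : ∀ {A : Set} {k} (a : A) (g : Fin (suc k) → A) → (a ∷ g) ⊆ʳ (g zero ∷ a ∷ tail g)
∷-swap-⊆ʳ a g zero          = suc zero , refl
∷-swap-⊆ʳ a g (suc zero)    = zero , refl
∷-swap-⊆ʳ a g (suc (suc i)) = suc (suc i) , refl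

∷-swap-⊇ʳ : ∀ {A : Set} {k} (a : A) (g : Fin (suc k) → A) → (g zero ∷ a ∷ tail g) ⊆ʳ (a ∷ g)
∷-swap-⊇ʳ a g zero          = suc zero , refl
∷-swap-⊇ʳ a g (suc zero)    = zero , refl
∷-swap-⊇ʳ a g (suc (suc i)) = suc (suc i) , refl

tail-increasing : ∀ {k n} {g : Fin (suc k) → Fin n} → Increasing g → Increasing (tail g)
tail-increasing g↑ i j i<j = g↑ (suc i) (suc j) (s≤s i<j)

∷-increasing : ∀ {k n} {a : Fin n} {g : Fin k → Fin n} →
  (∀ t → a Fin.< g t) → Increasing g → Increasing (a ∷ g)
∷-increasing a<g g↑ zero    (suc j) _         = a<g j
∷-increasing a<g g↑ (suc i) (suc j) (s≤s i<j) = g↑ i j i<j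

increasing-injective : ∀ {k n} {g : Fin k → Fin n} → Increasing g → Injective _≡_ _≡_ g
increasing-injective g↑ {i} {j} gi≡gj with <-cmp i j
... | tri< i<j _ _ = contradiction (cong toℕ gi≡gj) (ℕP.<⇒≢ (g↑ i j i<j))
... | tri≈ _ i≡j _ = i≡j
... | tri> _ _ j<i = contradiction (cong toℕ gi≡gj) (ℕP.>⇒≢ (g↑ j i j<i))

tail-injective : ∀ {k n} {f : Fin (suc k) → Fin n} → Injective _≡_ _≡_ f → Injective _≡_ _≡_ (tail f)
tail-injective f-inj = suc-injective ∘ f-inj

∷-tail-injective : ∀ {k n} {a : Fin n} {g : Fin (suc k) → Fin n} →
  Injective _≡_ _≡_ (a ∷ g) → Injective _≡_ _≡_ (a ∷ tail g)
∷-tail-injective inj {zero}  {zero}  _ = refl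
∷-tail-injective inj {zero}  {suc j} e = contradiction (inj {zero} {suc (suc j)} e) λ ()
∷-tail-injective inj {suc i} {zero}  e = contradiction (inj {suc (suc i)} {zero} e) λ ()
∷-tail-injective inj {suc i} {suc j} e = suc-injective (inj {suc (suc i)} {suc (suc j)} e)

∷-injective : ∀ {k m n} {f : Fin (suc k) → Fin n} {g : Fin m → Fin n} → Increasing g → g ⊆ʳ tail f →
  Injective _≡_ _≡_ f → Injective _≡_ _≡_ (f zero ∷ g)
∷-injective g↑ g⊆f f-inj {zero}  {zero}   _ = refl
∷-injective g↑ g⊆f f-inj {zero}  {suc t}  e with g⊆f t
... | i , gt≡fi = contradiction (f-inj (trans e gt≡fi)) λ ()
∷-injective g↑ g⊆f f-inj {suc t} {zero}   e with g⊆f t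
... | i , gt≡fi = contradiction (f-inj (trans (sym gt≡fi) e)) λ ()
∷-injective g↑ g⊆f f-inj {suc t} {suc t′} e = cong suc (increasing-injective g↑ e)

record RowsProportional {k n} (ε : ℤ) (f g : Fin k → Fin n) : Set where
  field detRows-∝ : ∀ B → detRows B f ≡ ε * detRows B g
open RowsProportional

record Vanishing {k n} (f : Fin k → Fin n) : Set where
  field detRows-≡0 : ∀ B → detRows B f ≡ 0ℤ
open Vanishing

proportional-refl : ∀ {k n} {f : Fin k → Fin n} → RowsProportional 1ℤ f f
proportional-refl .detRows-∝ B = sym (ℤP.*-identityˡ _)

proportional-trans : ∀ {k n} {ε ε′} {f g h : Fin k → Fin n} →
  RowsProportional ε f g → RowsProportional ε′ g h → RowsProportional (ε * ε′) f h
proportional-trans {ε = ε} {ε′} f∝g g∝h .detRows-∝ B =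
  trans (f∝g .detRows-∝ B) (trans (cong (ε *_) (g∝h .detRows-∝ B)) (sym (ℤP.*-assoc ε ε′ _)))

vanishing-proportional : ∀ {k n} {ε} {f g : Fin k → Fin n} →
  RowsProportional ε f g → Vanishing g → Vanishing f
vanishing-proportional {ε = ε} f∝g g≈0 .detRows-≡0 B =
  trans (f∝g .detRows-∝ B) (trans (cong (ε *_) (g≈0 .detRows-≡0 B)) (ℤP.*-zeroʳ ε))

-- In the Laplace expansion of detRows B f along its first row, f only enters
-- through f zero and tail f; hence the shapes f versus f zero ∷ g below, and
-- detRows B (a ∷ g) unfolds to the same term as detRows B (a ∷ g zero ∷ tail g).

proportional-∷ : ∀ {k n} {ε} {f : Fin (suc k) → Fin n} {g : Fin k → Fin n} →
  RowsProportional ε (tail f) g → RowsProportional ε f (f zero ∷ g)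
proportional-∷ {k} {ε = ε} {f} {g} f′∝g .detRows-∝ B = begin
  detRows B f                                 ≡⟨ sum-cong-≗ (λ j → cong (σ j *_) (f′∝g .detRows-∝ (B′ j))) ⟩
  sum (λ j → σ j * (ε * detRows (B′ j) g))    ≡⟨ sum-cong-≗ (λ j → x*[y*z]≡y*[x*z] (σ j) ε (detRows (B′ j) g)) ⟩
  sum (λ j → ε * (σ j * detRows (B′ j) g))    ≡⟨ *-distribˡ-sum ε (λ j → σ j * detRows (B′ j) g) ⟨
  ε * detRows B (f zero ∷ g)                  ∎
  where
  open ≡-Reasoning
  σ : Fin (suc k) → ℤ
  σ j = -1ℤ ^ toℕ j * B (f zero) j
  B′ : Fin (suc k) → Fin _ → Fin k → ℤ
  B′ j m c = B m (punchIn j c)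
  x*[y*z]≡y*[x*z] : ∀ x y z → x * (y * z) ≡ y * (x * z)
  x*[y*z]≡y*[x*z] = solve-∀

vanishing-∷ : ∀ {k n} {f : Fin (suc k) → Fin n} → Vanishing (tail f) → Vanishing f
vanishing-∷ {f = f} f′≈0 .detRows-≡0 B = sum-zero λ j →
  trans (cong (-1ℤ ^ toℕ j * B (f zero) j *_) (f′≈0 .detRows-≡0 (λ m c → B m (punchIn j c))))
        (ℤP.*-zeroʳ (-1ℤ ^ toℕ j * B (f zero) j))

proportional-swap : ∀ {k n} (a : Fin n) (g : Fin (suc k) → Fin n) →
  RowsProportional -1ℤ (a ∷ g) (g zero ∷ a ∷ tail g)
proportional-swap a g .detRows-∝ B =
  trans (detℤ-swap (B a) (B (g zero)) (B ∘ tail g)) (sym (ℤP.-1*i≡-i _))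

self-negating : ∀ {x} → x ≡ - x → x ≡ 0ℤ
self-negating {+0}        _  = refl
self-negating {+[1+ n ]}  ()
self-negating { -[1+ n ]} ()

vanishing-repeat : ∀ {k n} {a : Fin n} {g : Fin (suc k) → Fin n} → a ≡ g zero → Vanishing (a ∷ g)
vanishing-repeat {a = a} {g} refl .detRows-≡0 B = self-negating (detℤ-swap (B a) (B a) (B ∘ tail g))

data RowSorting {k n} (f : Fin k → Fin n) : Set where
  collision : ¬ Injective _≡_ _≡_ f → Vanishing f → RowSorting f
  sorted    : ∀ ε h → Increasing h → f ⊆ʳ h → h ⊆ʳ f → RowsProportional ε f h → RowSorting f

insert : ∀ {k n} (a : Fin n) (g : Fin k → Fin n) → Increasing g → RowSorting (a ∷ g)
insert {zero} a g g↑ = sorted 1ℤ (a ∷ g) (∷-increasing (λ ()) g↑) ⊆ʳ-refl ⊆ʳ-refl proportional-refl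
insert {suc k} a g g↑ with <-cmp a (g zero)
... | tri< a<g₀ _ _ = sorted 1ℤ (a ∷ g) (∷-increasing a<g g↑) ⊆ʳ-refl ⊆ʳ-refl proportional-refl
  where
  a<g : ∀ t → a Fin.< g t
  a<g zero    = a<g₀
  a<g (suc t) = ℕP.<-trans a<g₀ (g↑ zero (suc t) (s≤s z≤n))
... | tri≈ _ a≡g₀ _ =
  collision (λ inj → contradiction (inj {zero} {suc zero} a≡g₀) λ ()) (vanishing-repeat a≡g₀)
... | tri> _ _ g₀<a with insert a (tail g) (tail-increasing g↑)
...   | collision ¬inj a∷g′≈0 =
  collision (¬inj ∘ ∷-tail-injective) (vanishing-proportional (proportional-swap a g) (vanishing-∷ a∷g′≈0))
...   | sorted ε h h↑ ⊆h h⊆ ∝h =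
  sorted (-1ℤ * ε) (g zero ∷ h) (∷-increasing g₀<h h↑)
         (⊆ʳ-trans (∷-swap-⊆ʳ a g) (∷⁺-⊆ʳ (g zero) ⊆h))
         (⊆ʳ-trans (∷⁺-⊆ʳ (g zero) h⊆) (∷-swap-⊇ʳ a g))
         (proportional-trans (proportional-swap a g) (proportional-∷ ∝h))
  where
  g₀<a∷g′ : ∀ i → g zero Fin.< (a ∷ tail g) i
  g₀<a∷g′ zero    = g₀<a
  g₀<a∷g′ (suc i) = g↑ zero (suc i) (s≤s z≤n)
  g₀<h : ∀ t → g zero Fin.< h t
  g₀<h t with h⊆ t
  ... | i , ht≡ = subst (g zero Fin.<_) (sym ht≡) (g₀<a∷g′ i)

sortRows : ∀ {k n} (f : Fin k → Fin n) → RowSorting f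
sortRows {zero} f = sorted 1ℤ f (λ ()) ⊆ʳ-refl ⊆ʳ-refl proportional-refl
sortRows {suc k} f with sortRows (tail f)
... | collision ¬inj f′≈0 = collision (¬inj ∘ tail-injective) (vanishing-∷ f′≈0)
... | sorted ε g g↑ f′⊆g g⊆f′ f′∝g with insert (f zero) g g↑
...   | collision ¬inj f₀∷g≈0 =
  collision (¬inj ∘ ∷-injective g↑ g⊆f′) (vanishing-proportional (proportional-∷ f′∝g) f₀∷g≈0)
...   | sorted ε′ h h↑ ⊆h h⊆ ∝h =
  sorted (ε * ε′) h h↑ (⊆ʳ-trans (⊆ʳ-∷ f′⊆g) ⊆h) (⊆ʳ-trans h⊆ (∷-⊆ʳ g⊆f′))
         (proportional-trans (proportional-∷ f′∝g) ∝h)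

module Kronecker {A : Set} (_≟ᴬ_ : DecidableEquality A) where

  δ : A → A → ℤ
  δ x y = if ⌊ x ≟ᴬ y ⌋ then 1ℤ else 0ℤ

  δ-refl : ∀ x → δ x x ≡ 1ℤ
  δ-refl x with x ≟ᴬ x
  ... | yes _   = refl
  ... | no  x≢x = contradiction refl x≢x

  δ-≢ : ∀ {x y} → x ≢ y → δ x y ≡ 0ℤ
  δ-≢ {x} {y} x≢y with x ≟ᴬ y
  ... | yes x≡y = contradiction x≡y x≢y
  ... | no  _   = refl

  δ-sym : ∀ x y → δ x y ≡ δ y x
  δ-sym x y with x ≟ᴬ y
  ... | yes refl = sym (δ-refl x)
  ... | no  x≢y  = sym (δ-≢ (x≢y ∘ sym))

  sum-δ : ∀ {n} (e : Fin n ↔ A) x (G : A → ℤ) → sum (λ m → δ x (Inverse.to e m) * G (Inverse.to e m)) ≡ G x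
  sum-δ e x G = begin
    sum (λ m → δ x (φ m) * G (φ m))  ≡⟨ sum-single _ (ψ x) off-x ⟩
    δ x (φ (ψ x)) * G (φ (ψ x))      ≡⟨ cong (λ y → δ x y * G y) (Inverse.strictlyInverseˡ e x) ⟩
    δ x x * G x                      ≡⟨ cong (_* G x) (δ-refl x) ⟩
    1ℤ * G x                         ≡⟨ ℤP.*-identityˡ (G x) ⟩
    G x                              ∎
    where
    open ≡-Reasoning
    φ = Inverse.to e
    ψ = Inverse.from e
    off-x : ∀ m → m ≢ ψ x → δ x (φ m) * G (φ m) ≡ 0ℤ
    off-x m m≢ψx = cong (_* G (φ m)) (δ-≢ λ x≡φm →
      m≢ψx (trans (sym (Inverse.strictlyInverseʳ e m)) (cong ψ (sym x≡φm))))

δ-injective : ∀ {A B : Set} (_≟ᴬ_ : DecidableEquality A) (_≟ᴮ_ : DecidableEquality B) {φ : A → B} →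
  Injective _≡_ _≡_ φ → ∀ x y → Kronecker.δ _≟ᴮ_ (φ x) (φ y) ≡ Kronecker.δ _≟ᴬ_ x y
δ-injective _≟ᴬ_ _≟ᴮ_ {φ} φ-inj x y with x ≟ᴬ y
... | yes refl = Kronecker.δ-refl _≟ᴮ_ (φ x)
... | no  x≢y  = Kronecker.δ-≢ _≟ᴮ_ (x≢y ∘ φ-inj)

-- Iℤ i j unfolds to Kronecker.δ _≟_ i j.

*-Iℤ : ∀ {k} (Z : Fin k → ℤ) j → sum (λ t → Z t * Iℤ t j) ≡ Z j
*-Iℤ Z j = trans (sum-cong-≗ λ t → trans (ℤP.*-comm (Z t) (Iℤ t j)) (cong (_* Z t) (Kronecker.δ-sym _≟_ t j)))
                 (Kronecker.sum-δ _≟_ ↔-refl j Z)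

detℤ-Iℤ : ∀ k → detℤ (Iℤ {k}) ≡ 1ℤ
detℤ-Iℤ zero    = refl
detℤ-Iℤ (suc k) = begin
  1ℤ * 1ℤ * minor zero + sum (λ j → -1ℤ ^ toℕ (suc j) * 0ℤ * minor (suc j))
    ≡⟨ cong₂ _+_ (trans (ℤP.*-identityˡ _) (trans (detℤ-cong Iℤ-suc) (detℤ-Iℤ k)))
                 (sum-zero λ j → x*0*y≡0 (-1ℤ ^ toℕ (suc j)) (minor (suc j))) ⟩
  1ℤ + 0ℤ ∎
  where
  open ≡-Reasoning
  Iℤ-suc : ∀ r c → Iℤ {suc k} (suc r) (suc c) ≡ Iℤ r c
  Iℤ-suc = δ-injective _≟_ _≟_ suc-injective
  minor : Fin (suc k) → ℤ
  minor j = detℤ (λ r c → Iℤ {suc k} (suc r) (punchIn j c))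
  x*0*y≡0 : ∀ x y → x * 0ℤ * y ≡ 0ℤ
  x*0*y≡0 = solve-∀

increasing-lower : ∀ {k n} {h : Fin (suc k) → Fin n} → Increasing h →
  ∀ i → toℕ i ℕ.+ toℕ (h zero) ℕ.≤ toℕ (h i)
increasing-lower h↑ zero = ℕP.≤-refl
increasing-lower {suc k} {h = h} h↑ (suc i) = begin
  suc (toℕ i ℕ.+ toℕ (h zero))  ≡⟨ ℕP.+-suc (toℕ i) (toℕ (h zero)) ⟨
  toℕ i ℕ.+ suc (toℕ (h zero))  ≤⟨ ℕP.+-monoʳ-≤ (toℕ i) (h↑ zero (suc zero) (s≤s z≤n)) ⟩
  toℕ i ℕ.+ toℕ (h (suc zero))  ≤⟨ increasing-lower (tail-increasing h↑) i ⟩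
  toℕ (h (suc i))               ∎
  where open ℕP.≤-Reasoning

increasing-upper : ∀ {k n} {h : Fin k → Fin n} → Increasing h → ∀ i → toℕ (h i) ℕ.+ k ℕ.≤ n ℕ.+ toℕ i
increasing-upper {suc zero} {n} {h} h↑ zero = begin
  toℕ (h zero) ℕ.+ 1  ≡⟨ ℕP.+-comm (toℕ (h zero)) 1 ⟩
  suc (toℕ (h zero))  ≤⟨ toℕ<n (h zero) ⟩
  n                   ≡⟨ ℕP.+-identityʳ n ⟨
  n ℕ.+ 0             ∎
  where open ℕP.≤-Reasoning
increasing-upper {suc (suc k)} {n} {h} h↑ zero = begin
  toℕ (h zero) ℕ.+ suc (suc k)  ≡⟨ ℕP.+-suc (toℕ (h zero)) (suc k) ⟩
  suc (toℕ (h zero)) ℕ.+ suc k  ≤⟨ ℕP.+-monoˡ-≤ (suc k) (h↑ zero (suc zero) (s≤s z≤n)) ⟩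
  toℕ (h (suc zero)) ℕ.+ suc k  ≤⟨ increasing-upper (tail-increasing h↑) zero ⟩
  n ℕ.+ 0                       ∎
  where open ℕP.≤-Reasoning
increasing-upper {suc k} {n} {h} h↑ (suc i) = begin
  toℕ (h (suc i)) ℕ.+ suc k    ≡⟨ ℕP.+-suc (toℕ (h (suc i))) k ⟩
  suc (toℕ (h (suc i)) ℕ.+ k)  ≤⟨ s≤s (increasing-upper (tail-increasing h↑) i) ⟩
  suc (n ℕ.+ toℕ i)            ≡⟨ ℕP.+-suc n (toℕ i) ⟨
  n ℕ.+ suc (toℕ i)            ∎
  where open ℕP.≤-Reasoning

increasing-endo-id : ∀ {k} {h : Fin k → Fin k} → Increasing h → ∀ i → h i ≡ i
increasing-endo-id {suc k} {h} h↑ i = toℕ-injective (ℕP.≤-antisym h≤i i≤h)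
  where
  h≤i : toℕ (h i) ℕ.≤ toℕ i
  h≤i = ℕP.+-cancelʳ-≤ (suc k) (toℕ (h i)) (toℕ i)
          (ℕP.≤-trans (increasing-upper h↑ i) (ℕP.≤-reflexive (ℕP.+-comm (suc k) (toℕ i))))
  i≤h : toℕ i ℕ.≤ toℕ (h i)
  i≤h = ℕP.≤-trans (ℕP.m≤m+n (toℕ i) (toℕ (h zero))) (increasing-lower h↑ i)

-- 0 on maps that are not permutations
sgn : ∀ {k} → (Fin k → Fin k) → ℤ
sgn f with sortRows f
... | collision _ _      = 0ℤ
... | sorted ε _ _ _ _ _ = ε

detRows-endo : ∀ {k} (Y : Mat ℤ k) (f : Fin k → Fin k) → detRows Y f ≡ sgn f * detℤ Y
detRows-endo Y f with sortRows f
... | collision _ f≈0       = f≈0 .detRows-≡0 Y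
... | sorted ε h h↑ _ _ f∝h =
  trans (f∝h .detRows-∝ Y) (cong (ε *_) (detℤ-cong λ i j → cong (λ t → Y t j) (increasing-endo-id h↑ i)))

detℤ-linearCombinationRows : ∀ k {n} (P : Fin k → Fin n → ℤ) (B : Fin n → Fin k → ℤ) →
  detℤ (λ i j → sum λ m → P i m * B m j) ≡ sumMaps k (λ f → product (λ i → P i (f i)) * detRows B f)
detℤ-linearCombinationRows zero    P B = refl
detℤ-linearCombinationRows (suc k) P B = begin
  sum (λ j → σ j * S j * detℤ (λ r c → sum λ m → P (suc r) m * B′ j m c))
    ≡⟨ sum-cong-≗ (λ j → cong (σ j * S j *_) (detℤ-linearCombinationRows k (P ∘ suc) (B′ j))) ⟩
  sum (λ j → σ j * S j * sumMaps k (λ g → Π g * detRows (B′ j) g))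
    ≡⟨ sum-cong-≗ distribute ⟩
  sum (λ j → sum λ m → sumMaps k λ g → T j m g)
    ≡⟨ ∑-comm (λ j m → sumMaps k (T j m)) ⟩
  sum (λ m → sum λ j → sumMaps k λ g → T j m g)
    ≡⟨ sum-cong-≗ (λ m → sumMaps-sum k (λ j → T j m)) ⟨
  sum (λ m → sumMaps k λ g → sum λ j → T j m g)
    ≡⟨ sum-cong-≗ (λ m → sumMaps-cong k λ g →
         *-distribˡ-sum (P zero m * Π g) (λ j → σ j * B m j * detRows (B′ j) g)) ⟨
  sum (λ m → sumMaps k λ g → P zero m * Π g * detRows B (m ∷ g))
    ∎
  where
  open ≡-Reasoning
  σ : Fin (suc k) → ℤ
  σ j = -1ℤ ^ toℕ j
  S : Fin (suc k) → ℤ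
  S j = sum λ m → P zero m * B m j
  B′ : Fin (suc k) → Fin _ → Fin k → ℤ
  B′ j m c = B m (punchIn j c)
  Π : (Fin k → Fin _) → ℤ
  Π g = product (λ i → P (suc i) (g i))
  T : Fin (suc k) → Fin _ → (Fin k → Fin _) → ℤ
  T j m g = P zero m * Π g * (σ j * B m j * detRows (B′ j) g)
  regroup : ∀ s p b π d → s * (p * b) * (π * d) ≡ p * π * (s * b * d)
  regroup = solve-∀
  distribute : ∀ j → σ j * S j * sumMaps k (λ g → Π g * detRows (B′ j) g) ≡ sum λ m → sumMaps k λ g → T j m g
  distribute j = begin
    σ j * S j * D
      ≡⟨ cong (_* D) (*-distribˡ-sum (σ j) (λ m → P zero m * B m j)) ⟩
    (sum λ m → σ j * (P zero m * B m j)) * D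
      ≡⟨ *-distribʳ-sum D (λ m → σ j * (P zero m * B m j)) ⟩
    sum (λ m → σ j * (P zero m * B m j) * D)
      ≡⟨ sum-cong-≗ (λ m → *-distribˡ-sumMaps k (σ j * (P zero m * B m j)) (λ g → Π g * detRows (B′ j) g)) ⟩
    sum (λ m → sumMaps k λ g → σ j * (P zero m * B m j) * (Π g * detRows (B′ j) g))
      ≡⟨ sum-cong-≗ (λ m → sumMaps-cong k λ g → regroup (σ j) (P zero m) (B m j) (Π g) (detRows (B′ j) g)) ⟩
    sum (λ m → sumMaps k λ g → T j m g) ∎
    where D = sumMaps k (λ g → Π g * detRows (B′ j) g)

leibniz : ∀ {k} → Mat ℤ k → ℤ
leibniz {k} X = sumMaps k λ f → product (λ i → X i (f i)) * sgn f

detℤ-*≡leibniz-* : ∀ {k} (X Y : Mat ℤ k) → detℤ (λ i j → sum λ t → X i t * Y t j) ≡ leibniz X * detℤ Y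
detℤ-*≡leibniz-* {k} X Y = begin
  detℤ (λ i j → sum λ t → X i t * Y t j)
    ≡⟨ detℤ-linearCombinationRows k X Y ⟩
  sumMaps k (λ f → X⟨ f ⟩ * detRows Y f)
    ≡⟨ sumMaps-cong k (λ f → trans (cong (X⟨ f ⟩ *_) (detRows-endo Y f))
                                   (sym (ℤP.*-assoc X⟨ f ⟩ (sgn f) (detℤ Y)))) ⟩
  sumMaps k (λ f → X⟨ f ⟩ * sgn f * detℤ Y)
    ≡⟨ *-distribʳ-sumMaps k (detℤ Y) (λ f → X⟨ f ⟩ * sgn f) ⟨
  leibniz X * detℤ Y ∎
  where
  open ≡-Reasoning
  X⟨_⟩ : (Fin k → Fin k) → ℤ
  X⟨ f ⟩ = product (λ i → X i (f i))

detℤ≡leibniz : ∀ {k} (X : Mat ℤ k) → detℤ X ≡ leibniz X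
detℤ≡leibniz {k} X = begin
  detℤ X                                   ≡⟨ detℤ-cong (λ i j → *-Iℤ (X i) j) ⟨
  detℤ (λ i j → sum λ t → X i t * Iℤ t j)  ≡⟨ detℤ-*≡leibniz-* X Iℤ ⟩
  leibniz X * detℤ (Iℤ {k})                ≡⟨ cong (leibniz X *_) (detℤ-Iℤ k) ⟩
  leibniz X * 1ℤ                           ≡⟨ ℤP.*-identityʳ (leibniz X) ⟩
  leibniz X                                ∎
  where open ≡-Reasoning

detℤ-* : ∀ {k} (X Y : Mat ℤ k) → detℤ (λ i j → sum λ t → X i t * Y t j) ≡ detℤ X * detℤ Y
detℤ-* X Y = trans (detℤ-*≡leibniz-* X Y) (cong (_* detℤ Y) (sym (detℤ≡leibniz X)))

detℤ-permuteColumns : ∀ {k n} (X : Fin k → Fin n → ℤ) (h : Fin k → Fin n) (τ : Fin k → Fin k) →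
  detℤ (λ i j → X i (h (τ j))) ≡ detℤ (λ i j → X i (h j)) * detℤ (λ t j → Iℤ t (τ j))
detℤ-permuteColumns X h τ = trans (detℤ-cong λ i j → sym (*-Iℤ (λ t → X i (h t)) (τ j)))
                                  (detℤ-* (λ i t → X i (h t)) (λ t j → Iℤ t (τ j)))

sumMapsP : ∀ k {n V} → ((Fin k → Fin n) → Poly V) → Poly V
sumMapsP zero    F = F (λ ())
sumMapsP (suc k) F = sumP λ m → sumMapsP k (λ g → F (m ∷ g))

eval-sumMapsP : ∀ k {n V} (ρ : V → ℤ) (F : (Fin k → Fin n) → Poly V) →
  eval ρ (sumMapsP k F) ≡ sumMaps k (eval ρ ∘ F)
eval-sumMapsP zero    ρ F = refl
eval-sumMapsP (suc k) ρ F = trans (eval-sumP ρ (λ m → sumMapsP k (F ∘ (m ∷_))))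
                                  (sum-cong-≗ λ m → eval-sumMapsP k ρ (F ∘ (m ∷_)))

sumP-∈ : ∀ {V n} {S : Poly V → Set} {G : Fin n → Poly V} → (∀ m → InIdeal S (G m)) → InIdeal S (sumP G)
sumP-∈ {n = zero}  G∈ = zer
sumP-∈ {n = suc n} G∈ = add (G∈ zero) (sumP-∈ (G∈ ∘ suc))

sumMapsP-∈ : ∀ k {n V} {S : Poly V → Set} {F : (Fin k → Fin n) → Poly V} →
  (∀ g → InIdeal S (F g)) → InIdeal S (sumMapsP k F)
sumMapsP-∈ zero    F∈ = F∈ (λ ())
sumMapsP-∈ (suc k) F∈ = sumP-∈ λ m → sumMapsP-∈ k (F∈ ∘ (m ∷_))

module _ {V : Set} {n : ℕ} (M : Mat (Poly V) n) where

  minor-increasingColumns∈ : ∀ {k} (F : Fin k → Fin n) (h : Fin k → Fin n) → Increasing h →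
    MinorIdeal M k (det λ i t → M (F i) (h t))
  minor-increasingColumns∈ F h h↑ = by (sortRows F)
    where
    open ≡-Reasoning
    Mₕ : (V → ℤ) → Fin n → Fin _ → ℤ
    Mₕ ρ m t = eval ρ (M m (h t))
    by : RowSorting F → MinorIdeal M _ (det λ i t → M (F i) (h t))
    by (collision _ F≈0) =
      resp (λ ρ → sym (trans (eval-det ρ (λ i t → M (F i) (h t))) (F≈0 .detRows-≡0 (Mₕ ρ)))) zer
    by (sorted ε F′ F′↑ _ _ F∝F′) =
      resp (λ ρ → begin
          ε * eval ρ (det λ i t → M (F′ i) (h t))  ≡⟨ cong (ε *_) (eval-det ρ (λ i t → M (F′ i) (h t))) ⟩
          ε * detRows (Mₕ ρ) F′                    ≡⟨ F∝F′ .detRows-∝ (Mₕ ρ) ⟨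
          detRows (Mₕ ρ) F                         ≡⟨ eval-det ρ (λ i t → M (F i) (h t)) ⟨
          eval ρ (det λ i t → M (F i) (h t))       ∎)
        (mul (con ε) (gen (F′ , h , F′↑ , h↑ , refl)))

  minor-injectiveColumns∈ : ∀ {k} (F : Fin k → Fin n) (f : Fin k → Fin n) → Injective _≡_ _≡_ f →
    MinorIdeal M k (det λ i t → M (F i) (f t))
  minor-injectiveColumns∈ F f f-inj = by (sortRows f)
    where
    open ≡-Reasoning
    MF : (V → ℤ) → Fin _ → Fin n → ℤ
    MF ρ i l = eval ρ (M (F i) l)
    by : RowSorting f → MinorIdeal M _ (det λ i t → M (F i) (f t))
    by (collision ¬inj _) = ⊥-elim (¬inj f-inj)
    by (sorted _ h h↑ f⊆h _ _) =
      resp (λ ρ → begin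
          cτ * eval ρ (det λ i t → M (F i) (h t))  ≡⟨ cong (cτ *_) (eval-det ρ (λ i t → M (F i) (h t))) ⟩
          cτ * detℤ (λ i t → MF ρ i (h t))        ≡⟨ ℤP.*-comm cτ _ ⟩
          detℤ (λ i t → MF ρ i (h t)) * cτ        ≡⟨ detℤ-permuteColumns (MF ρ) h τ ⟨
          detℤ (λ i t → MF ρ i (h (τ t)))         ≡⟨ detℤ-cong (λ i t → cong (MF ρ i) (proj₂ (f⊆h t))) ⟨
          detℤ (λ i t → MF ρ i (f t))             ≡⟨ eval-det ρ (λ i t → M (F i) (f t)) ⟨
          eval ρ (det λ i t → M (F i) (f t))       ∎)
        (mul (con cτ) (minor-increasingColumns∈ F h h↑))
      where
      τ : Fin _ → Fin _
      τ = proj₁ ∘ f⊆h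
      cτ : ℤ
      cτ = detℤ λ t j → Iℤ t (τ j)

module _ {V : Set} {n : ℕ} (M M′ : Mat (Poly V) n) (P : Mat ℤ n)
         (π : Fin n → Fin n) (π-inj : Injective _≡_ _≡_ π)
         (M′≡P·M : ∀ ρ i j → eval ρ (M′ i j) ≡ sum λ m → P i m * eval ρ (M m (π j))) where

  minor-∈ : ∀ {k} (r c : Fin k → Fin n) → Increasing c → MinorIdeal M k (det λ i j → M′ (r i) (c j))
  minor-∈ {k} r c c↑ = resp (λ ρ → sym (expand ρ)) (sumMapsP-∈ k λ F →
    mul (con (coefficient F)) (minor-injectiveColumns∈ M F (π ∘ c) (increasing-injective c↑ ∘ π-inj)))
    where
    open ≡-Reasoning
    coefficient : (Fin k → Fin n) → ℤ
    coefficient F = product λ i → P (r i) (F i)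
    term : (Fin k → Fin n) → Poly V
    term F = con (coefficient F) ⊗ det (λ i t → M (F i) (π (c t)))
    expand : ∀ ρ → eval ρ (det λ i j → M′ (r i) (c j)) ≡ eval ρ (sumMapsP k term)
    expand ρ = begin
      eval ρ (det λ i j → M′ (r i) (c j))
        ≡⟨ eval-det ρ (λ i j → M′ (r i) (c j)) ⟩
      detℤ (λ i j → eval ρ (M′ (r i) (c j)))
        ≡⟨ detℤ-cong (λ i j → M′≡P·M ρ (r i) (c j)) ⟩
      detℤ (λ i j → sum λ m → P (r i) m * eval ρ (M m (π (c j))))
        ≡⟨ detℤ-linearCombinationRows k (P ∘ r) (λ m j → eval ρ (M m (π (c j)))) ⟩
      sumMaps k (λ F → coefficient F * detRows (λ m j → eval ρ (M m (π (c j)))) F)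
        ≡⟨ sumMaps-cong k (λ F → cong (coefficient F *_) (eval-det ρ (λ i t → M (F i) (π (c t))))) ⟨
      sumMaps k (eval ρ ∘ term)
        ≡⟨ eval-sumMapsP k ρ term ⟨
      eval ρ (sumMapsP k term) ∎

  minorIdeal-⊆ : ∀ k p → MinorIdeal M′ k p → MinorIdeal M k p
  minorIdeal-⊆ k _ (gen (r , c , _ , c↑ , refl)) = minor-∈ r c c↑
  minorIdeal-⊆ k _ zer                           = zer
  minorIdeal-⊆ k _ (add p∈ q∈)                   = add (minorIdeal-⊆ k _ p∈) (minorIdeal-⊆ k _ q∈)
  minorIdeal-⊆ k _ (mul c p∈)                    = mul c (minorIdeal-⊆ k _ p∈)
  minorIdeal-⊆ k _ (resp p≈q p∈)                 = resp p≈q (minorIdeal-⊆ k _ p∈)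

addMultipleOfRow-inverse : ∀ {A : Set} (p : A) (c : A → ℤ) (M₁ M₂ : A → A → ℤ) → c p ≡ 0ℤ →
  (∀ x y → M₁ x y ≡ M₂ x y + c x * M₂ p y) → ∀ x y → M₂ x y ≡ M₁ x y + - c x * M₁ p y
addMultipleOfRow-inverse p c M₁ M₂ cp≡0 M₁≡ x y = begin
  M₂ x y                                  ≡⟨ cancel (M₂ x y) (c x) (M₂ p y) ⟩
  M₂ x y + c x * M₂ p y + - c x * M₂ p y  ≡⟨ cong₂ (λ s t → s + - c x * t) (M₁≡ x y) row-p ⟨
  M₁ x y + - c x * M₁ p y                 ∎
  where
  open ≡-Reasoning
  cancel : ∀ m a r → m ≡ m + a * r + - a * r
  cancel = solve-∀
  row-p : M₁ p y ≡ M₂ p y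
  row-p = trans (M₁≡ p y) (trans (cong (λ t → M₂ p y + t * M₂ p y) cp≡0) (ℤP.+-identityʳ (M₂ p y)))

module RowOperation {A : Set} (_≟ᴬ_ : DecidableEquality A) (p : A) where
  open Kronecker _≟ᴬ_

  rowOp : (A → ℤ) → A → A → ℤ
  rowOp c x y = δ x y + c x * δ p y

  rowOp-inverse : ∀ (c : A → ℤ) → c p ≡ 0ℤ → ∀ x y → δ x y ≡ rowOp c x y + - c x * rowOp c p y
  rowOp-inverse c cp≡0 = addMultipleOfRow-inverse p c (rowOp c) δ cp≡0 (λ _ _ → refl)

  sum-rowOp : ∀ {n} (e : Fin n ↔ A) (c : A → ℤ) x (G : A → ℤ) →
    sum (λ m → rowOp c x (Inverse.to e m) * G (Inverse.to e m)) ≡ G x + c x * G p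
  sum-rowOp e c x G = begin
    sum (λ m → rowOp c x (φ m) * G (φ m))
      ≡⟨ sum-cong-≗ (λ m → distrib (δ x (φ m)) (c x) (δ p (φ m)) (G (φ m))) ⟩
    sum (λ m → δ x (φ m) * G (φ m) + c x * (δ p (φ m) * G (φ m)))
      ≡⟨ ∑-distrib-+ (λ m → δ x (φ m) * G (φ m)) (λ m → c x * (δ p (φ m) * G (φ m))) ⟩
    sum (λ m → δ x (φ m) * G (φ m)) + sum (λ m → c x * (δ p (φ m) * G (φ m)))
      ≡⟨ cong (_+_ (sum λ m → δ x (φ m) * G (φ m))) (*-distribˡ-sum (c x) (λ m → δ p (φ m) * G (φ m))) ⟨
    sum (λ m → δ x (φ m) * G (φ m)) + c x * sum (λ m → δ p (φ m) * G (φ m))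
      ≡⟨ cong₂ (λ s t → s + c x * t) (sum-δ e x G) (sum-δ e p G) ⟩
    G x + c x * G p ∎
    where
    open ≡-Reasoning
    φ = Inverse.to e
    distrib : ∀ d a d′ g → (d + a * d′) * g ≡ d * g + a * (d′ * g)
    distrib = solve-∀

  rowOp-GL : ∀ {n} (e₁ e₂ : Fin n ↔ A) (c : A → ℤ) → c p ≡ 0ℤ →
    GL (λ i j → rowOp c (Inverse.to e₁ i) (Inverse.to e₂ j))
  rowOp-GL e₁ e₂ c cp≡0 =
    (λ i j → rowOp (-_ ∘ c) (Inverse.to e₂ i) (Inverse.to e₁ j)) ,
    product≡Iℤ e₁ e₂ c (-_ ∘ c) (cong -_ cp≡0) (λ x → sym (ℤP.neg-involutive (c x))) ,
    product≡Iℤ e₂ e₁ (-_ ∘ c) c cp≡0 (λ _ → refl)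
    where
    product≡Iℤ : ∀ (e e′ : Fin _ ↔ A) (c d : A → ℤ) → d p ≡ 0ℤ → (∀ x → c x ≡ - d x) → ∀ i j →
      sumℤ (λ m → rowOp c (Inverse.to e i) (Inverse.to e′ m) * rowOp d (Inverse.to e′ m) (Inverse.to e j))
        ≡ Iℤ i j
    product≡Iℤ e e′ c d dp≡0 c≡-d i j = begin
      sumℤ (λ m → rowOp c x (φ m) * rowOp d (φ m) y)
        ≡⟨ sumℤ≡sum (λ m → rowOp c x (φ m) * rowOp d (φ m) y) ⟩
      sum (λ m → rowOp c x (φ m) * rowOp d (φ m) y)
        ≡⟨ sum-rowOp e′ c x (λ z → rowOp d z y) ⟩
      rowOp d x y + c x * rowOp d p y
        ≡⟨ cong (λ t → rowOp d x y + t * rowOp d p y) (c≡-d x) ⟩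
      rowOp d x y + - d x * rowOp d p y
        ≡⟨ rowOp-inverse d dp≡0 x y ⟨
      δ x y
        ≡⟨ δ-injective _≟_ _≟ᴬ_ (Injection.injective (↔⇒↣ e)) i j ⟩
      Iℤ i j ∎
      where
      open ≡-Reasoning
      φ = Inverse.to e′
      x = Inverse.to e i
      y = Inverse.to e j

module _ (a b : ℕ) where

  orderD : Fin (N a b) ↔ Vert a b
  orderD = mk↔ₛ′ (vertD a b) index vertD-index index-vertD
    where
    index : Vert a b → Fin (N a b)
    index (u p) = (p ↑ˡ b) ↑ˡ 1
    index (w q) = (a ↑ʳ q) ↑ˡ 1
    index v     = (a ℕ.+ b) ↑ʳ zero
    vertD-index : ∀ x → vertD a b (index x) ≡ x
    vertD-index (u p) rewrite splitAt-↑ˡ (a ℕ.+ b) (p ↑ˡ b) 1 | splitAt-↑ˡ a p b = refl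
    vertD-index (w q) rewrite splitAt-↑ˡ (a ℕ.+ b) (a ↑ʳ q) 1 | splitAt-↑ʳ a b q = refl
    vertD-index v     rewrite splitAt-↑ʳ (a ℕ.+ b) 1 zero = refl
    index-vertD : ∀ i → index (vertD a b i) ≡ i
    index-vertD i with splitAt (a ℕ.+ b) i in eq
    ... | inj₂ zero = splitAt⁻¹-↑ʳ eq
    ... | inj₁ k with splitAt a k in eq′
    ...   | inj₁ p = trans (cong (_↑ˡ 1) (splitAt⁻¹-↑ˡ eq′)) (splitAt⁻¹-↑ˡ eq)
    ...   | inj₂ q = trans (cong (_↑ˡ 1) (splitAt⁻¹-↑ʳ eq′)) (splitAt⁻¹-↑ˡ eq)

  orderL : Fin (N a b) ↔ Vert a b
  orderL = mk↔ₛ′ (vertL a b) index vertL-index index-vertL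
    where
    index′ : Vert a b → Fin (ℕ.suc (b ℕ.+ a))
    index′ v     = zero
    index′ (w q) = suc (q ↑ˡ a)
    index′ (u p) = suc (b ↑ʳ p)
    vertL′-index′ : ∀ x → vertL' a b (index′ x) ≡ x
    vertL′-index′ v     = refl
    vertL′-index′ (w q) rewrite splitAt-↑ˡ b q a = refl
    vertL′-index′ (u p) rewrite splitAt-↑ʳ b a p = refl
    index′-vertL′ : ∀ i → index′ (vertL' a b i) ≡ i
    index′-vertL′ zero = refl
    index′-vertL′ (suc k) with splitAt b k in eq
    ... | inj₁ q = cong suc (splitAt⁻¹-↑ˡ eq)
    ... | inj₂ p = cong suc (splitAt⁻¹-↑ʳ eq)
    index : Vert a b → Fin (N a b)
    index = cast (sym (N≡ a b)) ∘ index′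
    vertL-index : ∀ x → vertL a b (index x) ≡ x
    vertL-index x =
      trans (cong (vertL' a b) (cast-involutive (N≡ a b) (sym (N≡ a b)) (index′ x))) (vertL′-index′ x)
    index-vertL : ∀ i → index (vertL a b i) ≡ i
    index-vertL i = trans (cong (cast (sym (N≡ a b))) (index′-vertL′ (cast (N≡ a b) i)))
                          (cast-involutive (sym (N≡ a b)) (N≡ a b) i)

  relabel : Fin (N a b) ↔ Fin (N a b)
  relabel = ↔-trans orderL (↔-sym orderD)

  _≟ᵥ_ : DecidableEquality (Vert a b)
  u i ≟ᵥ u i′ = map′ (cong u) (λ { refl → refl }) (i ≟ i′)
  w j ≟ᵥ w j′ = map′ (cong w) (λ { refl → refl }) (j ≟ j′)
  v   ≟ᵥ v    = yes refl
  u _ ≟ᵥ w _  = no λ ()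
  u _ ≟ᵥ v    = no λ ()
  w _ ≟ᵥ u _  = no λ ()
  w _ ≟ᵥ v    = no λ ()
  v   ≟ᵥ u _  = no λ ()
  v   ≟ᵥ w _  = no λ ()

  open Kronecker _≟ᵥ_ using (δ; δ-refl; δ-≢; δ-sym; sum-δ)
  open RowOperation _≟ᵥ_ v using (rowOp; sum-rowOp; rowOp-GL)

  D̂ : (Vert a b → ℤ) → Vert a b → Vert a b → ℤ
  D̂ ρ x y = δ x y * ρ x + dist x y

  L̂ : (Vert a b → ℤ) → Vert a b → Vert a b → ℤ
  L̂ ρ x y = δ x y * ρ x + eval ρ (Lblock x y)

  multiplier : Vert a b → ℤ
  multiplier v     = 0ℤ
  multiplier (w _) = - (+ 2)
  multiplier (u _) = - (+ 1)

  eval-Lblock : ∀ ρ x y → eval ρ (Lblock x y) ≡ dist x y + multiplier x * D̂ ρ v y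
  eval-Lblock ρ v     v      = refl
  eval-Lblock ρ v     (w _)  = refl
  eval-Lblock ρ v     (u _)  = refl
  eval-Lblock ρ (w _) v      = w-row (ρ v)
    where
    w-row : ∀ x → + 1 + - (+ 2 * x) ≡ + 1 + - (+ 2) * (1ℤ * x + + 0)
    w-row = solve-∀
  eval-Lblock ρ (w j) (w j′) with j ≟ j′
  ... | yes _ = refl
  ... | no  _ = refl
  eval-Lblock ρ (w _) (u _)  = refl
  eval-Lblock ρ (u _) v      = u-row (ρ v)
    where
    u-row : ∀ x → + 2 + - x ≡ + 2 + - (+ 1) * (1ℤ * x + + 0)
    u-row = solve-∀
  eval-Lblock ρ (u _) (w _)  = refl
  eval-Lblock ρ (u i) (u i′) with i ≟ i′
  ... | yes _ = refl
  ... | no  _ = refl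

  L̂-rowOp : ∀ ρ x y → L̂ ρ x y ≡ D̂ ρ x y + multiplier x * D̂ ρ v y
  L̂-rowOp ρ x y = trans (cong (_+_ (δ x y * ρ x)) (eval-Lblock ρ x y))
                        (sym (ℤP.+-assoc (δ x y * ρ x) (dist x y) (multiplier x * D̂ ρ v y)))

  D̂-rowOp : ∀ ρ x y → D̂ ρ x y ≡ L̂ ρ x y + - multiplier x * L̂ ρ v y
  D̂-rowOp ρ = addMultipleOfRow-inverse v multiplier (L̂ ρ) (D̂ ρ) refl (L̂-rowOp ρ)

  eval-diagonal : ∀ (e : Fin (N a b) ↔ Vert a b) ρ i j →
    eval ρ (if ⌊ i ≟ j ⌋ then var (Inverse.to e i) else con 0ℤ) ≡
    δ (Inverse.to e i) (Inverse.to e j) * ρ (Inverse.to e i)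
  eval-diagonal e ρ i j with i ≟ j
  ... | yes refl = sym (trans (cong (_* ρ x) (δ-refl x)) (ℤP.*-identityˡ (ρ x)))
    where x = Inverse.to e i
  ... | no  i≢j  = sym (cong (_* ρ (Inverse.to e i)) (δ-≢ (i≢j ∘ Injection.injective (↔⇒↣ e))))

  eval-DX : ∀ ρ i j → eval ρ (DX a b i j) ≡ D̂ ρ (vertD a b i) (vertD a b j)
  eval-DX ρ i j = cong (_+ dist (vertD a b i) (vertD a b j)) (eval-diagonal orderD ρ i j)

  eval-Lmat : ∀ ρ i j → eval ρ (Lmat a b i j) ≡ L̂ ρ (vertL a b i) (vertL a b j)
  eval-Lmat ρ i j = cong (_+ eval ρ (Lblock (vertL a b i) (vertL a b j))) (eval-diagonal orderL ρ i j)

  P : Mat ℤ (N a b)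
  P i m = rowOp multiplier (vertL a b i) (vertD a b m)

  P⁻¹ : Mat ℤ (N a b)
  P⁻¹ i m = rowOp (-_ ∘ multiplier) (vertD a b i) (vertL a b m)

  -- with multiplier 0, rowOp is the permutation matrix between the two vertex orders
  Q : Mat ℤ (N a b)
  Q l j = rowOp (λ _ → 0ℤ) (vertD a b l) (vertL a b j)

  GL-P : GL P
  GL-P = rowOp-GL orderL orderD multiplier refl

  GL-Q : GL Q
  GL-Q = rowOp-GL orderD orderL (λ _ → 0ℤ) refl

  Lmat-rows : ∀ ρ i j → eval ρ (Lmat a b i j) ≡ sum λ m → P i m * D̂ ρ (vertD a b m) (vertL a b j)
  Lmat-rows ρ i j = begin
    eval ρ (Lmat a b i j)                    ≡⟨ eval-Lmat ρ i j ⟩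
    L̂ ρ x y                                  ≡⟨ L̂-rowOp ρ x y ⟩
    D̂ ρ x y + multiplier x * D̂ ρ v y         ≡⟨ sum-rowOp orderD multiplier x (λ z → D̂ ρ z y) ⟨
    sum (λ m → P i m * D̂ ρ (vertD a b m) y)  ∎
    where
    open ≡-Reasoning
    x = vertL a b i
    y = vertL a b j

  Lmat≡P·DX : ∀ ρ i j → eval ρ (Lmat a b i j) ≡ sum λ m → P i m * eval ρ (DX a b m (Inverse.to relabel j))
  Lmat≡P·DX ρ i j = trans (Lmat-rows ρ i j) (sum-cong-≗ λ m → cong (P i m *_) (sym (
    trans (eval-DX ρ m (Inverse.to relabel j))
          (cong (D̂ ρ (vertD a b m)) (Inverse.strictlyInverseˡ orderD (vertL a b j))))))

  DX≡P⁻¹·Lmat : ∀ ρ i j →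
    eval ρ (DX a b i j) ≡ sum λ m → P⁻¹ i m * eval ρ (Lmat a b m (Inverse.from relabel j))
  DX≡P⁻¹·Lmat ρ i j = begin
    eval ρ (DX a b i j)
      ≡⟨ eval-DX ρ i j ⟩
    D̂ ρ x y
      ≡⟨ D̂-rowOp ρ x y ⟩
    L̂ ρ x y + - multiplier x * L̂ ρ v y
      ≡⟨ sum-rowOp orderL (-_ ∘ multiplier) x (λ z → L̂ ρ z y) ⟨
    sum (λ m → P⁻¹ i m * L̂ ρ (vertL a b m) y)
      ≡⟨ sum-cong-≗ (λ m → cong (P⁻¹ i m *_) (sym (
           trans (eval-Lmat ρ m (Inverse.from relabel j))
                 (cong (L̂ ρ (vertL a b m)) (Inverse.strictlyInverseˡ orderL y))))) ⟩
    sum (λ m → P⁻¹ i m * eval ρ (Lmat a b m (Inverse.from relabel j))) ∎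
    where
    open ≡-Reasoning
    x = vertD a b i
    y = vertD a b j

  Lmat≈P·DX·Q : ∀ i j → Lmat a b i j ≈ triple P (DX a b) Q i j
  Lmat≈P·DX·Q i j ρ = begin
    eval ρ (Lmat a b i j)
      ≡⟨ Lmat-rows ρ i j ⟩
    sum (λ k → P i k * D̂ ρ (vertD a b k) y)
      ≡⟨ sum-cong-≗ (λ k → trans (sum-cong-≗ (permute k))
                                 (sum-δ orderD y (λ z → P i k * D̂ ρ (vertD a b k) z))) ⟨
    sum (λ k → sum λ l → P i k * eval ρ (DX a b k l) * Q l j)
      ≡⟨ sum-cong-≗ (λ k → eval-sumP ρ (λ l → con (P i k) ⊗ DX a b k l ⊗ con (Q l j))) ⟨
    sum (λ k → eval ρ (sumP λ l → con (P i k) ⊗ DX a b k l ⊗ con (Q l j)))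
      ≡⟨ eval-sumP ρ (λ k → sumP λ l → con (P i k) ⊗ DX a b k l ⊗ con (Q l j)) ⟨
    eval ρ (triple P (DX a b) Q i j) ∎
    where
    open ≡-Reasoning
    y = vertL a b j
    reorder : ∀ p d e → p * d * (e + 0ℤ) ≡ e * (p * d)
    reorder = solve-∀
    permute : ∀ k l → P i k * eval ρ (DX a b k l) * Q l j ≡
                      δ y (vertD a b l) * (P i k * D̂ ρ (vertD a b k) (vertD a b l))
    permute k l = begin
      P i k * eval ρ (DX a b k l) * Q l j
        ≡⟨ cong (λ t → P i k * t * Q l j) (eval-DX ρ k l) ⟩
      P i k * D̂ₖₗ * (δ (vertD a b l) y + 0ℤ)
        ≡⟨ reorder (P i k) D̂ₖₗ (δ (vertD a b l) y) ⟩
      δ (vertD a b l) y * (P i k * D̂ₖₗ)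
        ≡⟨ cong (_* (P i k * D̂ₖₗ)) (δ-sym (vertD a b l) y) ⟩
      δ y (vertD a b l) * (P i k * D̂ₖₗ) ∎
      where D̂ₖₗ = D̂ ρ (vertD a b k) (vertD a b l)

  Ik⊆minorIdeal-Lmat : ∀ k p → Ik a b k p → MinorIdeal (Lmat a b) k p
  Ik⊆minorIdeal-Lmat = minorIdeal-⊆ (Lmat a b) (DX a b) P⁻¹ (Inverse.from relabel)
                                     (Injection.injective (↔⇒↣ (↔-sym relabel))) DX≡P⁻¹·Lmat

  minorIdeal-Lmat⊆Ik : ∀ k p → MinorIdeal (Lmat a b) k p → Ik a b k p
  minorIdeal-Lmat⊆Ik = minorIdeal-⊆ (DX a b) (Lmat a b) P (Inverse.to relabel)
                                     (Injection.injective (↔⇒↣ relabel)) Lmat≡P·DX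

lemma17 : (a b : ℕ) → 1 ≤ b →
    (Σ (Mat ℤ (N a b)) λ P → Σ (Mat ℤ (N a b)) λ Q →
       GL P × GL Q × (∀ i j → Lmat a b i j ≈ triple P (DX a b) Q i j))
    × (∀ (k : ℕ) → Ik a b k ≐ MinorIdeal (Lmat a b) k)
lemma17 a b _ =
  (P a b , Q a b , GL-P a b , GL-Q a b , Lmat≈P·DX·Q a b) ,
  λ k → Ik⊆minorIdeal-Lmat a b k , minorIdeal-Lmat⊆Ik a b k
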